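{- Let $m\le n$ and let $\sigma\le n$. For $m\times n$ arrays with entries from an alphabet $\{0,\dots,\sigma-1\}$ of size $\sigma$, at least $(\sigma-1)\log m + \log\binom{n}{\sigma-1}$ bits are necessary to answer 1-sided RMQ.
   Context: For a 2D array $A[1..m][1..n]$ and a rectangle $[i_1,i_2]\times[j_1,j_2]$, $\mathsf{rmq}(i_1,i_2,j_1,j_2)$ returns the position of a smallest element in the rectangle, ties broken by returning the top-leftmost such position. A 1-sided RMQ is a query with range $[1,m]\times[1,j]$ for $j\in[n]$. "At least $X$ bits are necessary" means that the number of distinct answer functions (query $\mapsto$ answer) induced by all admissible input arrays is at least $2^X$. -}

module Defs where

open import Data.Nat using (ℕ; _<ᵇ_)
open import Data.Fin using (Fin; toℕ)
open import Data.Fin.Properties using (_≤?_)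
open import Data.List using (List; []; _∷_; allFin; map; concatMap; foldl)
open import Data.Maybe using (Maybe; just; nothing)
open import Data.Product using (_×_; _,_)
open import Data.Bool using (Bool; true; false; if_then_else_; _∧_)
open import Relation.Nullary.Decidable using (⌊_⌋)

Array : ℕ → ℕ → ℕ → Set
Array m n σ = Fin m → Fin n → Fin σ

Pos : ℕ → ℕ → Set
Pos m n = Fin m × Fin n

keep : {A : Set} → (A → Bool) → List A → List A
keep p [] = []
keep p (x ∷ xs) = if p x then x ∷ keep p xs else keep p xs

rect : {m n : ℕ} → Fin m → Fin m → Fin n → Fin n → List (Pos m n)
rect {m} {n} i₁ i₂ j₁ j₂ =
  concatMap (λ r → map (λ c → r , c)
                       (keep (λ c → ⌊ j₁ ≤? c ⌋ ∧ ⌊ c ≤? j₂ ⌋) (allFin n)))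
            (keep (λ r → ⌊ i₁ ≤? r ⌋ ∧ ⌊ r ≤? i₂ ⌋) (allFin m))

-- scanning in row-major order, keep the first position of a strictly
-- smallest value: this is the top-leftmost minimum
step : {m n σ : ℕ} → Array m n σ → Maybe (Pos m n) → Pos m n → Maybe (Pos m n)
step A nothing p = just p
step A (just (r' , c')) (r , c) =
  if toℕ (A r c) <ᵇ toℕ (A r' c') then just (r , c) else just (r' , c')

argminIn : {m n σ : ℕ} → Array m n σ → List (Pos m n) → Maybe (Pos m n)
argminIn A = foldl (step A) nothing

-- rmq(i₁,i₂,j₁,j₂): position of the top-leftmost smallest element
-- (nothing only for an empty rectangle)
rmq : {m n σ : ℕ} → Array m n σ → Fin m → Fin m → Fin n → Fin n → Maybe (Pos m n)
rmq A i₁ i₂ j₁ j₂ = argminIn A (rect i₁ i₂ j₁ j₂)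

rect1 : {m n : ℕ} → Fin n → List (Pos m n)
rect1 {m} {n} j =
  concatMap (λ r → map (λ c → r , c) (keep (λ c → ⌊ c ≤? j ⌋) (allFin n))) (allFin m)

rmq1 : {m n σ : ℕ} → Array m n σ → Fin n → Maybe (Pos m n)
rmq1 A j = argminIn A (rect1 j)

-- Choose k = σ - 1 of the n columns and one of the m rows in each chosen
-- column: there are m^k · C(n,k) such markings.  In the array of a marking,
-- the marked cell of a chosen column holds the number of chosen columns to
-- its right and every other cell holds k.  The prefix [1,m] × [1,j] then has
-- a unique minimum, the marked cell of the last chosen column ≤ j, unless no
-- chosen column is ≤ j, in which case the prefix is constant.  Hence the
-- 1-sided answers recover every chosen column together with its row.
module Submission where

open import Defs
open import Data.Nat using (ℕ; _≤_; _^_; _*_; _∸_)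
open import Data.Nat.Combinatorics using (_C_)
open import Data.Fin using (Fin)
open import Data.Product using (Σ)
open import Relation.Binary.PropositionalEquality using (_≡_)

open import Data.Bool using (Bool; true; false; T; T?; if_then_else_)
open import Data.Empty using (⊥-elim)
open import Data.Fin as Fin using (zero; suc; toℕ; fromℕ<)
open import Data.Fin.Properties using (_≟_; _≤?_; toℕ-fromℕ<; +↔⊎; *↔×)
open import Data.List using (List; []; _∷_; foldl; head; allFin; map; filterᵇ)
open import Data.List.Membership.Propositional using (_∈_)
open import Data.List.Membership.Propositional.Properties
  using (∈-filter⁺; ∈-filter⁻; ∈-map⁺; ∈-map⁻; ∈-concatMap⁺; ∈-concatMap⁻; ∈-allFin)
open import Data.List.Relation.Unary.All as All using (All; []; _∷_)
open import Data.List.Relation.Unary.Any as Any using (here; there)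
open import Data.Maybe as Maybe using (Maybe; just; nothing; fromMaybe)
open import Data.Maybe.Properties using (just-injective; map-injective)
open import Data.Nat as ℕ using (zero; suc; _+_; _<_; _<ᵇ_; z≤n; s≤s)
open import Data.Nat.Combinatorics using (nCk+nC[k+1]≡[n+1]C[k+1])
open import Data.Nat.Properties
  using (1+n≢n; *-zeroʳ; *-assoc; *-distribˡ-+; ≤-refl; ≤-reflexive; ≤-trans; <⇒≤; <⇒≱; ≮⇒≥;
         <-≤-trans; m<n⇒m<1+n; <ᵇ-reflects-<)
open import Data.Product using (∃-syntax; _×_; _,_; proj₁; proj₂; uncurry)
open import Data.Product.Function.NonDependent.Propositional using (_×-↣_)
open import Data.Product.Properties using (≡-dec)
open import Data.Sum using (_⊎_; inj₁; inj₂; [_,_]′)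
open import Data.Sum.Function.Propositional using (_⊎-↣_)
open import Function using (_∘_; _∋_)
open import Function.Bundles using (_↣_; mk↣; Injection)
open import Function.Construct.Composition using (_↣-∘_)
open import Function.Construct.Identity using (↣-id)
open import Function.Definitions using (Injective)
open import Function.Properties.Inverse using (↔⇒↣)
open import Relation.Binary.PropositionalEquality
  using (_≢_; refl; sym; trans; cong; cong₂; subst; subst₂; module ≡-Reasoning)
open import Relation.Nullary using (yes; no)
open import Relation.Nullary.Decidable using (⌊_⌋; toWitness; fromWitness)
open import Relation.Nullary.Reflects using (ofʸ; ofⁿ)

private
  variable
    X : Set
    m n σ k : ℕ

keep≡filterᵇ : (p : X → Bool) (xs : List X) → keep p xs ≡ filterᵇ p xs
keep≡filterᵇ p [] = refl
keep≡filterᵇ p (x ∷ xs) with p x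
... | true  = cong (x ∷_) (keep≡filterᵇ p xs)
... | false = keep≡filterᵇ p xs

∈-keep⁺ : (p : X → Bool) {x : X} {xs : List X} → x ∈ xs → T (p x) → x ∈ keep p xs
∈-keep⁺ p {xs = xs} x∈xs px rewrite keep≡filterᵇ p xs = ∈-filter⁺ (T? ∘ p) {xs = xs} x∈xs px

∈-keep⁻ : (p : X → Bool) {x : X} {xs : List X} → x ∈ keep p xs → T (p x)
∈-keep⁻ p {xs = xs} x∈keep rewrite keep≡filterᵇ p xs = proj₂ (∈-filter⁻ (T? ∘ p) {xs = xs} x∈keep)

upTo : Fin n → Fin n → Bool
upTo j c = ⌊ c ≤? j ⌋

rowPrefix : Fin n → Fin m → List (Pos m n)
rowPrefix {n} j r = map (r ,_) (keep (upTo j) (allFin n))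

∈-rect1⁺ : {j : Fin n} {q : Pos m n} → proj₂ q Fin.≤ j → q ∈ rect1 j
∈-rect1⁺ {n} {m} {j} {i , c} c≤j = ∈-concatMap⁺ (rowPrefix j) {xs = allFin m} (Any.map q∈row (∈-allFin i))
  where
  q∈row : ∀ {r} → i ≡ r → (i , c) ∈ rowPrefix j r
  q∈row refl = ∈-map⁺ (i ,_) (∈-keep⁺ (upTo j) {xs = allFin n} (∈-allFin c) (fromWitness c≤j))

∈-rect1⁻ : {j : Fin n} {q : Pos m n} → q ∈ rect1 j → proj₂ q Fin.≤ j
∈-rect1⁻ {n} {m} {j} q∈ with Any.satisfied (∈-concatMap⁻ (rowPrefix j) {xs = allFin m} q∈)
... | r , q∈row with ∈-map⁻ (r ,_) q∈row
...   | c , c∈ , refl = toWitness (∈-keep⁻ (upTo j) {xs = allFin n} c∈)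

module _ (A : Array m n σ) where

  entry : Pos m n → ℕ
  entry (i , c) = toℕ (A i c)

  foldl-step-head : ∀ {s L} → All (λ q → entry s ≤ entry q) L → foldl (step A) (just s) L ≡ just s
  foldl-step-head {L = []}    []          = refl
  foldl-step-head {s} {x ∷ L} (s≤x ∷ s≤L) with entry x <ᵇ entry s | <ᵇ-reflects-< (entry x) (entry s)
  ... | true  | ofʸ x<s = ⊥-elim (<⇒≱ x<s s≤x)
  ... | false | _       = foldl-step-head s≤L

  foldl-step-min : ∀ s L → ∃[ p ] foldl (step A) (just s) L ≡ just p × p ∈ s ∷ L
                                 × All (λ q → entry p ≤ entry q) (s ∷ L)
  foldl-step-min s [] = s , refl , here refl , ≤-refl ∷ []
  foldl-step-min s (x ∷ L) with entry x <ᵇ entry s | <ᵇ-reflects-< (entry x) (entry s)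
  ... | true  | ofʸ x<s with foldl-step-min x L
  ...   | p , eq , p∈ , p≤x ∷ p≤L = p , eq , there p∈ , ≤-trans p≤x (<⇒≤ x<s) ∷ p≤x ∷ p≤L
  foldl-step-min s (x ∷ L) | false | ofⁿ x≮s with foldl-step-min s L
  ...   | p , eq , p∈ , p≤s ∷ p≤L = p , eq , skipSecond p∈ , p≤s ∷ ≤-trans p≤s (≮⇒≥ x≮s) ∷ p≤L
    where
    skipSecond : ∀ {p} → p ∈ s ∷ L → p ∈ s ∷ x ∷ L
    skipSecond (here e)   = here e
    skipSecond (there p∈) = there (there p∈)

  argminIn-constant : ∀ {L e} → (∀ {q} → q ∈ L → entry q ≡ e) → argminIn A L ≡ head L
  argminIn-constant {[]}    _        = refl
  argminIn-constant {s ∷ L} entries≡ =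
    foldl-step-head (All.tabulate λ q∈L →
      ≤-reflexive (trans (entries≡ (here refl)) (sym (entries≡ (there q∈L)))))

  argminIn-strictMin : ∀ {L p} → p ∈ L → (∀ {q} → q ∈ L → q ≢ p → entry p < entry q) →
                    argminIn A L ≡ just p
  argminIn-strictMin {s ∷ L} {p} p∈L p-strict with foldl-step-min s L
  ... | p₀ , eq , p₀∈L , p₀-min with ≡-dec _≟_ _≟_ p₀ p
  ...   | yes refl = eq
  ...   | no p₀≢p  = ⊥-elim (<⇒≱ (p-strict p₀∈L p₀≢p) (All.lookup p₀-min p∈L))

data Marking (m : ℕ) : ℕ → ℕ → Set where
  []   : Marking m zero zero
  mark : Fin m → Marking m n k → Marking m (suc n) (suc k)
  skip : Marking m n k → Marking m (suc n) k

countMarkings : ℕ → ℕ → ℕ → ℕ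
countMarkings m n       zero    = 1
countMarkings m zero    (suc k) = 0
countMarkings m (suc n) (suc k) = m * countMarkings m n k + countMarkings m n (suc k)

countMarkings≡ : ∀ m n k → countMarkings m n k ≡ m ^ k * (n C k)
countMarkings≡ m n       zero    = refl
countMarkings≡ m zero    (suc k) = sym (*-zeroʳ (m ^ suc k))
countMarkings≡ m (suc n) (suc k) = begin
  m * countMarkings m n k + countMarkings m n (suc k)
    ≡⟨ cong₂ (λ x y → m * x + y) (countMarkings≡ m n k) (countMarkings≡ m n (suc k)) ⟩
  m * (m ^ k * (n C k)) + m ^ suc k * (n C suc k)
    ≡⟨ cong (_+ m ^ suc k * (n C suc k)) (*-assoc m (m ^ k) (n C k)) ⟨
  m ^ suc k * (n C k) + m ^ suc k * (n C suc k)
    ≡⟨ *-distribˡ-+ (m ^ suc k) (n C k) (n C suc k) ⟨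
  m ^ suc k * (n C k + n C suc k)
    ≡⟨ cong (m ^ suc k *_) (nCk+nC[k+1]≡[n+1]C[k+1] n k) ⟩
  m ^ suc k * (suc n C suc k) ∎
  where open ≡-Reasoning

unmarked : Marking m n zero
unmarked {n = zero}  = []
unmarked {n = suc n} = skip unmarked

markOrSkip : ((Fin m × Marking m n k) ⊎ Marking m n (suc k)) ↣ Marking m (suc n) (suc k)
markOrSkip = mk↣ injective
  where
  injective : Injective _≡_ _≡_ [ uncurry mark , skip ]′
  injective {inj₁ _} {inj₁ _} refl = refl
  injective {inj₂ _} {inj₂ _} refl = refl

fromIndex : Fin (countMarkings m n k) ↣ Marking m n k
fromIndex {n = n}     {zero}  = mk↣ {to = λ _ → unmarked} λ { {zero} {zero} _ → refl }
fromIndex {n = zero}  {suc k} = mk↣ {to = λ ()} λ { {()} }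
fromIndex {n = suc n} {suc k} =
  markOrSkip ↣-∘ (((↣-id _ ×-↣ fromIndex) ⊎-↣ fromIndex) ↣-∘ ((↔⇒↣ *↔× ⊎-↣ ↣-id _) ↣-∘ ↔⇒↣ +↔⊎))

markings : ∀ {m n k} → Fin (m ^ k * (n C k)) ↣ Marking m n k
markings {m} {n} {k} = subst (λ N → Fin N ↣ Marking m n k) (countMarkings≡ m n k) fromIndex

shift : Pos m n → Pos m (suc n)
shift (i , c) = i , suc c

shift-injective : {p q : Pos m n} → shift p ≡ shift q → p ≡ q
shift-injective refl = refl

lastMark : Marking m n k → Fin n → Maybe (Pos m n)
lastMark (mark r a) zero    = just (r , zero)
lastMark (mark r a) (suc j) = just (fromMaybe (r , zero) (Maybe.map shift (lastMark a j)))
lastMark (skip a)   zero    = nothing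
lastMark (skip a)   (suc j) = Maybe.map shift (lastMark a j)

-- With no mark in the columns ≤ j the prefix is constant, and rmq1 returns its top-left cell.
answer : Marking (suc m) (suc n) k → Fin (suc n) → Pos (suc m) (suc n)
answer a j = fromMaybe (zero , zero) (lastMark a j)

fromMaybe-shift-injective : ∀ {r r′ : Fin m} {x y : Maybe (Pos m n)} →
  fromMaybe (r , zero) (Maybe.map shift x) ≡ fromMaybe (r′ , zero) (Maybe.map shift y) → x ≡ y
fromMaybe-shift-injective {x = nothing} {nothing} _    = refl
fromMaybe-shift-injective {x = just _}  {just _}  refl = refl

lastMark-injective : ∀ {k k′} (a : Marking m n k) (b : Marking m n k′) →
  (∀ j → lastMark a j ≡ lastMark b j) → (Σ ℕ (Marking m n) ∋ (k , a)) ≡ (k′ , b)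
lastMark-injective [] [] _ = refl
lastMark-injective (mark r a) (mark r′ b) same
  with refl ← same zero
     | refl ← lastMark-injective a b (λ j → fromMaybe-shift-injective (just-injective (same (suc j)))) = refl
lastMark-injective (mark r a) (skip b) same with () ← same zero
lastMark-injective (skip a) (mark r b) same with () ← same zero
lastMark-injective (skip a) (skip b) same
  with refl ← lastMark-injective a b (λ j → map-injective shift-injective (same (suc j))) = refl

-- The corner answers both an unmarked first column and a mark in its first row;
-- the two cases differ in the number of marks in the remaining columns.
answer-injective : (a b : Marking (suc m) (suc n) k) → (∀ j → answer a j ≡ answer b j) → a ≡ b
answer-injective (mark r a) (mark r′ b) same
  with refl ← same zero
     | refl ← lastMark-injective a b (λ j → fromMaybe-shift-injective (same (suc j))) = refl
answer-injective (mark r a) (skip b) same =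
  ⊥-elim (1+n≢n (sym (cong proj₁ (lastMark-injective a b λ j → fromMaybe-shift-injective (same (suc j))))))
answer-injective (skip a) (mark r b) same =
  ⊥-elim (1+n≢n (cong proj₁ (lastMark-injective a b λ j → fromMaybe-shift-injective (same (suc j)))))
answer-injective (skip a) (skip b) same
  with refl ← lastMark-injective a b (λ j → fromMaybe-shift-injective (same (suc j))) = refl

module Values (blank : ℕ) where

  value : Marking m n k → Pos m n → ℕ
  value (mark {k = k} r a) (i , zero) = if ⌊ i ≟ r ⌋ then k else blank
  value (skip a)           (i , zero) = blank
  value (mark r a)         (i , suc c) = value a (i , c)
  value (skip a)           (i , suc c) = value a (i , c)

  value-marked : (r : Fin m) (a : Marking m n k) → value (mark r a) (r , zero) ≡ k
  value-marked r a with r ≟ r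
  ... | yes _  = refl
  ... | no r≢r = ⊥-elim (r≢r refl)

  value-unmarked : {i r : Fin m} (a : Marking m n k) → i ≢ r → value (mark r a) (i , zero) ≡ blank
  value-unmarked {i = i} {r} a i≢r with i ≟ r
  ... | yes i≡r = ⊥-elim (i≢r i≡r)
  ... | no _    = refl

  value-mark-≥ : k ≤ blank → (r i : Fin m) (a : Marking m n k) → k ≤ value (mark r a) (i , zero)
  value-mark-≥ k≤blank r i a with i ≟ r
  ... | yes _ = ≤-refl
  ... | no _  = k≤blank

  value≤blank : k ≤ blank → (a : Marking m n k) (q : Pos m n) → value a q ≤ blank
  value≤blank k≤blank (mark r a) (i , zero) with i ≟ r
  ... | yes _ = <⇒≤ k≤blank
  ... | no _  = ≤-refl
  value≤blank k≤blank (skip a)   (i , zero)  = ≤-refl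
  value≤blank k≤blank (mark r a) (i , suc c) = value≤blank (<⇒≤ k≤blank) a (i , c)
  value≤blank k≤blank (skip a)   (i , suc c) = value≤blank k≤blank a (i , c)

  lastMark-column : (a : Marking m n k) {j : Fin n} {p : Pos m n} →
                    lastMark a j ≡ just p → proj₂ p Fin.≤ j
  lastMark-column (mark r a) {zero} refl = z≤n
  lastMark-column (mark r a) {suc j} eq with lastMark a j in eq′
  lastMark-column (mark r a) {suc j} refl | nothing = z≤n
  lastMark-column (mark r a) {suc j} refl | just p = s≤s (lastMark-column a eq′)
  lastMark-column (skip a) {suc j} eq with lastMark a j in eq′
  lastMark-column (skip a) {suc j} refl | just p = s≤s (lastMark-column a eq′)

  lastMark-value< : (a : Marking m n k) {j : Fin n} {p : Pos m n} →
                    lastMark a j ≡ just p → value a p < k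
  lastMark-value< (mark r a) {zero} refl = ≤-reflexive (cong suc (value-marked r a))
  lastMark-value< (mark r a) {suc j} eq with lastMark a j in eq′
  lastMark-value< (mark r a) {suc j} refl | nothing = ≤-reflexive (cong suc (value-marked r a))
  lastMark-value< (mark r a) {suc j} refl | just p = m<n⇒m<1+n (lastMark-value< a eq′)
  lastMark-value< (skip a) {suc j} eq with lastMark a j in eq′
  lastMark-value< (skip a) {suc j} refl | just p = lastMark-value< a eq′

  value-blank : (a : Marking m n k) {j : Fin n} → lastMark a j ≡ nothing →
                {q : Pos m n} → proj₂ q Fin.≤ j → value a q ≡ blank
  value-blank [] {()}
  value-blank (mark r a) {zero} ()
  value-blank (mark r a) {suc j} ()
  value-blank (skip a) {j}     _ {i , zero}  _         = refl
  value-blank (skip a) {suc j} _ {i , suc c} (s≤s c≤j) with lastMark a j in eq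
  ... | nothing = value-blank a eq c≤j

  value-mark-< : {i r : Fin m} → suc k ≤ blank → (a : Marking m n k) → i ≢ r →
                 value (mark r a) (r , zero) < value (mark r a) (i , zero)
  value-mark-< {r = r} k<blank a i≢r =
    subst₂ _<_ (sym (value-marked r a)) (sym (value-unmarked a i≢r)) k<blank

  lastMark-strict : k ≤ blank → (a : Marking m n k) {j : Fin n} {p : Pos m n} →
                    lastMark a j ≡ just p →
                    {q : Pos m n} → proj₂ q Fin.≤ j → q ≢ p → value a p < value a q
  lastMark-strict k≤blank (mark r a) {zero} refl {i , zero} _ q≢p =
    value-mark-< k≤blank a (q≢p ∘ cong (_, zero))
  lastMark-strict k≤blank (mark r a) {suc j} eq c≤j q≢p with lastMark a j in eq′
  lastMark-strict k≤blank (mark r a) {suc j} refl {i , zero} _ q≢p | nothing =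
    value-mark-< k≤blank a (q≢p ∘ cong (_, zero))
  lastMark-strict k≤blank (mark r a) {suc j} refl {i , suc c} (s≤s c≤j) q≢p | nothing =
    subst₂ _<_ (sym (value-marked r a)) (sym (value-blank a eq′ c≤j)) k≤blank
  lastMark-strict k≤blank (mark r a) {suc j} refl {i , zero} _ q≢p | just p =
    <-≤-trans (lastMark-value< a eq′) (value-mark-≥ (<⇒≤ k≤blank) r i a)
  lastMark-strict k≤blank (mark r a) {suc j} refl {i , suc c} (s≤s c≤j) q≢p | just p =
    lastMark-strict (<⇒≤ k≤blank) a eq′ c≤j (q≢p ∘ cong shift)
  lastMark-strict k≤blank (skip a) {suc j} eq c≤j q≢p with lastMark a j in eq′
  lastMark-strict k≤blank (skip a) {suc j} refl {i , zero} _ q≢p | just p =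
    <-≤-trans (lastMark-value< a eq′) k≤blank
  lastMark-strict k≤blank (skip a) {suc j} refl {i , suc c} (s≤s c≤j) q≢p | just p =
    lastMark-strict k≤blank a eq′ c≤j (q≢p ∘ cong shift)

  toArray : k ≤ blank → Marking m n k → Array m n (suc blank)
  toArray k≤blank a i c = fromℕ< (s≤s (value≤blank k≤blank a (i , c)))

  entry-toArray : (k≤blank : k ≤ blank) (a : Marking m n k) (q : Pos m n) →
                  entry (toArray k≤blank a) q ≡ value a q
  entry-toArray k≤blank a q = toℕ-fromℕ< _

  rmq1-toArray : (k≤blank : k ≤ blank) (a : Marking (suc m) (suc n) k) (j : Fin (suc n)) →
                 rmq1 (toArray k≤blank a) j ≡ just (answer a j)
  rmq1-toArray k≤blank a j with lastMark a j in eq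
  ... | nothing = argminIn-constant (toArray k≤blank a) λ q∈ →
    trans (entry-toArray k≤blank a _) (value-blank a eq (∈-rect1⁻ q∈))
  ... | just p = argminIn-strictMin (toArray k≤blank a) (∈-rect1⁺ (lastMark-column a eq)) λ q∈ q≢p →
    subst₂ _<_ (sym (entry-toArray k≤blank a p)) (sym (entry-toArray k≤blank a _))
           (lastMark-strict k≤blank a eq (∈-rect1⁻ q∈) q≢p)

  toArray-rmq1-injective : (k≤blank : k ≤ blank) (a b : Marking (suc m) (suc n) k) →
    (∀ j → rmq1 (toArray k≤blank a) j ≡ rmq1 (toArray k≤blank b) j) → a ≡ b
  toArray-rmq1-injective k≤blank a b same = answer-injective a b λ j →
    just-injective (trans (sym (rmq1-toArray k≤blank a j)) (trans (same j) (rmq1-toArray k≤blank b j)))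

theorem7 : (m n σ : ℕ) → 1 ≤ m → m ≤ n → 1 ≤ σ → σ ≤ n →
    Σ (Fin (m ^ (σ ∸ 1) * (n C (σ ∸ 1))) → Array m n σ) (λ As →
      (i i′ : Fin (m ^ (σ ∸ 1) * (n C (σ ∸ 1)))) →
      ((j : Fin n) → rmq1 (As i) j ≡ rmq1 (As i′) j) → i ≡ i′)
theorem7 zero    _       _       () _  _  _
theorem7 (suc m) _       zero    _  _  () _
theorem7 (suc m) zero    (suc k) _  _  _  ()
theorem7 (suc m) (suc n) (suc k) _  _  _  _ = array , array-injective
  where
  open Values k
  marking : Fin (suc m ^ k * (suc n C k)) ↣ Marking (suc m) (suc n) k
  marking = markings
  array : Fin (suc m ^ k * (suc n C k)) → Array (suc m) (suc n) (suc k)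
  array i = toArray ≤-refl (Injection.to marking i)
  array-injective : ∀ i i′ → (∀ j → rmq1 (array i) j ≡ rmq1 (array i′) j) → i ≡ i′
  array-injective i i′ same = Injection.injective marking
    (toArray-rmq1-injective ≤-refl (Injection.to marking i) (Injection.to marking i′) same)
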